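{- If $G$ and $H$ are graphs such that $\gamma(G)=2=\gamma(H)$ and neither $G$ nor $H$ has an ECD set of size $2$, then $\gamma(G\diamond H)=3$.
   Context: All graphs are finite, simple and undirected. The modular product $G\diamond H$ has vertex set $V(G)\times V(H)$, and two distinct vertices $(g,h)$ and $(g',h')$ are adjacent iff either ($g=g'$ and $hh'\in E(H)$), or ($gg'\in E(G)$ and $h=h'$), or ($gg'\in E(G)$ and $hh'\in E(H)$), or ($g\neq g'$, $h\neq h'$, $gg'\notin E(G)$ and $hh'\notin E(H)$). $\gamma$ is the domination number. A set $D\subseteq V(G)$ is an efficiently closed dominating (ECD) set of $G$ if the closed neighborhoods $\{N_G[v]:v\in D\}$ form a partition of $V(G)$. -}

module Defs where

open import Data.Nat using (ℕ; _*_; _<_)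
open import Data.Fin using (Fin; remQuot)
open import Data.Fin.Subset using (Subset; _∈_; ∣_∣)
open import Data.Bool using (Bool; true; false; not; _∧_; _∨_)
open import Data.Product using (Σ; ∃; ∃-syntax; _×_; _,_; proj₁; proj₂)
open import Data.Sum using (_⊎_)
open import Relation.Binary.PropositionalEquality using (_≡_; _≢_)
open import Relation.Nullary using (¬_)

record Graph : Set where
  field
    n     : ℕ
    adj   : Fin n → Fin n → Bool
    adj-sym : ∀ u v → adj u v ≡ adj v u
    adj-irrefl : ∀ v → adj v v ≡ false

open Graph public

Adj : (G : Graph) → Fin (n G) → Fin (n G) → Set
Adj G u v = adj G u v ≡ true

InClosedNbhd : (G : Graph) → Fin (n G) → Fin (n G) → Set
InClosedNbhd G u v = (u ≡ v) ⊎ Adj G u v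

Dominating : (G : Graph) → Subset (n G) → Set
Dominating G D = ∀ u → ∃[ d ] (d ∈ D × InClosedNbhd G u d)

DominationNumberIs : Graph → ℕ → Set
DominationNumberIs G k =
  (∃[ D ] (Dominating G D × ∣ D ∣ ≡ k)) ×
  (∀ D → Dominating G D → ¬ (∣ D ∣ < k))

-- D is an efficiently closed dominating set: the closed neighbourhoods
-- {N[v] : v ∈ D} partition V(G), i.e. every vertex lies in N[d] for
-- exactly one d ∈ D.  (Closed neighbourhoods are nonempty, so the
-- blocks are nonempty and distinct d give disjoint hence distinct blocks.)
ECD : (G : Graph) → Subset (n G) → Set
ECD G D =
  Dominating G D ×
  (∀ u d d′ → d ∈ D → d′ ∈ D → InClosedNbhd G u d → InClosedNbhd G u d′ → d ≡ d′)

open import Data.Fin using (_≟_)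
open import Relation.Nullary using (does)

eqb : ∀ {k} → Fin k → Fin k → Bool
eqb i j = does (i ≟ j)

modAdj : (G H : Graph) → Fin (n G) → Fin (n H) → Fin (n G) → Fin (n H) → Bool
modAdj G H g h g′ h′ =
  (eqb g g′ ∧ adj H h h′) ∨
  (adj G g g′ ∧ eqb h h′) ∨
  (adj G g g′ ∧ adj H h h′) ∨
  (not (eqb g g′) ∧ not (eqb h h′) ∧ not (adj G g g′) ∧ not (adj H h h′))

-- The modular product G ◇ H, on vertex set Fin (n G * n H) ≅ V(G) × V(H)
-- via the standard bijection remQuot / combine.
modAdj′ : (G H : Graph) → Fin (n G * n H) → Fin (n G * n H) → Bool
modAdj′ G H x y =
  modAdj G H (proj₁ (remQuot {n G} (n H) x)) (proj₂ (remQuot {n G} (n H) x))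
             (proj₁ (remQuot {n G} (n H) y)) (proj₂ (remQuot {n G} (n H) y))

open import Relation.Binary.PropositionalEquality using (refl; cong; sym; trans)
open import Relation.Nullary using (yes; no)

eqb-refl : ∀ {k} (i : Fin k) → eqb i i ≡ true
eqb-refl i with i ≟ i
... | yes _ = refl
... | no ¬p = Data.Empty.⊥-elim (¬p refl)
  where import Data.Empty

eqb-sym : ∀ {k} (i j : Fin k) → eqb i j ≡ eqb j i
eqb-sym i j with i ≟ j | j ≟ i
... | yes _ | yes _ = refl
... | no _ | no _ = refl
... | yes p | no q = Data.Empty.⊥-elim (q (sym p))
  where import Data.Empty
... | no p | yes q = Data.Empty.⊥-elim (p (sym q))
  where import Data.Empty

modAdj-sym : ∀ G H g h g′ h′ → modAdj G H g h g′ h′ ≡ modAdj G H g′ h′ g h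
modAdj-sym G H g h g′ h′
  rewrite eqb-sym g g′ | eqb-sym h h′ | Graph.adj-sym G g g′ | Graph.adj-sym H h h′ = refl

modAdj-irrefl : ∀ G H g h → modAdj G H g h g h ≡ false
modAdj-irrefl G H g h
  rewrite eqb-refl g | eqb-refl h | Graph.adj-irrefl G g | Graph.adj-irrefl H h = refl

modAdj′-sym : ∀ G H x y → modAdj′ G H x y ≡ modAdj′ G H y x
modAdj′-sym G H x y =
  modAdj-sym G H (proj₁ (remQuot {n G} (n H) x)) (proj₂ (remQuot {n G} (n H) x))
                 (proj₁ (remQuot {n G} (n H) y)) (proj₂ (remQuot {n G} (n H) y))

modAdj′-irrefl : ∀ G H x → modAdj′ G H x x ≡ false
modAdj′-irrefl G H x =
  modAdj-irrefl G H (proj₁ (remQuot {n G} (n H) x)) (proj₂ (remQuot {n G} (n H) x))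

_◇_ : Graph → Graph → Graph
G ◇ H = record
  { n = n G * n H
  ; adj = modAdj′ G H
  ; adj-sym = modAdj′-sym G H
  ; adj-irrefl = modAdj′-irrefl G H
  }

{-# OPTIONS --safe #-}
-- A vertex (x , y) of G ◇ H lies in N[(g , h)] exactly when x ∈ N[g] and
-- y ∈ N[h] have the same truth value. Hence if {g₁ , g₂} dominates G and
-- {h₁ , h₂} dominates H, then (g₁ , h₁), (g₂ , h₂), (g₁ , h₂) dominate G ◇ H.
-- Conversely, if (g₁ , h₁) and (g₂ , h₂) dominated G ◇ H, then with aᵢ, bᵢ
-- the indicator functions of N[gᵢ], N[hᵢ] we would have a₁ x = b₁ y or
-- a₂ x = b₂ y for all x, y. As γ = 2 no indicator is constant, and as there
-- is no ECD set of size 2 no a₂ is the complement of a₁ (nor b₂ of b₁); this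
-- forces a₂ = a₁ and b₂ = b₁, so a₁ x = b₁ y for all x, y, which is absurd.
module Submission where

open import Defs
open import Data.Fin.Subset using (Subset; ∣_∣)
open import Relation.Binary.PropositionalEquality using (_≡_)
open import Relation.Nullary using (¬_)

open import Data.Bool using (Bool; true; false; not; _∧_; _∨_; _xor_; if_then_else_)
open import Data.Bool.Properties using (∨-zeroʳ; ¬-not; xor-same; if-eta) renaming (_≟_ to _≟ᵇ_)
open import Data.Fin using (Fin; combine; _≟_)
open import Data.Fin.Properties
  using (remQuot-combine; combine-injective; combine-surjective; ¬∀⟶∃¬)
open import Data.Fin.Subset using (_∈_; _⊆_; _∪_; _-_; ⁅_⁆; Nonempty; inside; outside)
open import Data.Fin.Subset.Properties
  using (x∈⁅x⁆; x∈⁅y⁆⇒x≡y; ∣⁅x⁆∣≡1; ∣⊥∣≡0; ∣p∣≤∣x∷p∣; p⊆q⇒∣p∣≤∣q∣; nonempty?; Empty-unique;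
         x∈p∪q⁺; x∈p∪q⁻; x∈p∧x≢y⇒x∈p-y; x∈p⇒∣p-x∣<∣p∣)
open import Data.Nat using (suc; _+_; _*_; _≤_; _<_; z≤n; s≤s)
open import Data.Nat.Properties
  using (≤-reflexive; ≤-trans; ≤-pred; +-suc; +-monoʳ-≤; <⇒≱; >⇒≢; ≤∧≮⇒≡)
open import Data.Vec using ([]; _∷_)
open import Data.Product using (∃; ∃₂; _×_; _,_; proj₁; proj₂; map₂)
open import Data.Sum using (_⊎_; inj₁; inj₂; [_,_]′)
import Data.Sum as Sum
open import Function using (id; _∘_; _⇔_; mk⇔; Equivalence)
open import Relation.Binary.PropositionalEquality
  using (refl; sym; trans; cong; cong₂; subst; _≗_; module ≡-Reasoning)
open import Relation.Nullary using (yes; no; contradiction)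
open import Relation.Nullary.Decidable using (dec-false)

open Equivalence using (to; from)

x∈p⇒0<∣p∣ : ∀ {m} {p : Subset m} {x} → x ∈ p → 0 < ∣ p ∣
x∈p⇒0<∣p∣ {p = p} {x} x∈p = subst (_≤ ∣ p ∣) (∣⁅x⁆∣≡1 x) (p⊆q⇒∣p∣≤∣q∣ ⁅x⁆⊆p)
  where
  ⁅x⁆⊆p : ⁅ x ⁆ ⊆ p
  ⁅x⁆⊆p y∈⁅x⁆ = subst (_∈ p) (sym (x∈⁅y⁆⇒x≡y x y∈⁅x⁆)) x∈p

0<∣p∣⇒Nonempty : ∀ {m} {p : Subset m} → 0 < ∣ p ∣ → Nonempty p
0<∣p∣⇒Nonempty {m} {p} 0<∣p∣ with nonempty? p
... | yes p≢∅ = p≢∅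
... | no  p≡∅ = contradiction (trans (cong ∣_∣ (Empty-unique p≡∅)) (∣⊥∣≡0 m)) (>⇒≢ 0<∣p∣)

x∈p⇒x≡y⊎x∈p-y : ∀ {m} {p : Subset m} {x} y → x ∈ p → x ≡ y ⊎ x ∈ p - y
x∈p⇒x≡y⊎x∈p-y {x = x} y x∈p with x ≟ y
... | yes x≡y = inj₁ x≡y
... | no  x≢y = inj₂ (x∈p∧x≢y⇒x∈p-y x∈p x≢y)

∣p∣≤1⇒x∈p⇒y∈p⇒y≡x : ∀ {m} {p : Subset m} {x y} → ∣ p ∣ ≤ 1 → x ∈ p → y ∈ p → y ≡ x
∣p∣≤1⇒x∈p⇒y∈p⇒y≡x ∣p∣≤1 x∈p y∈p with x∈p⇒x≡y⊎x∈p-y _ y∈p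
... | inj₁ y≡x   = y≡x
... | inj₂ y∈p-x = contradiction (≤-trans ∣p∣≤1 (x∈p⇒0<∣p∣ y∈p-x)) (<⇒≱ (x∈p⇒∣p-x∣<∣p∣ x∈p))

∣p∣≤2⇒⊆pair : ∀ {m} {p : Subset m} → Nonempty p → ∣ p ∣ ≤ 2 →
              ∃₂ λ x y → ∀ {z} → z ∈ p → z ≡ x ⊎ z ≡ y
∣p∣≤2⇒⊆pair {p = p} (x , x∈p) ∣p∣≤2 with nonempty? (p - x)
... | no  p-x≡∅ = x , x , Sum.map₂ (λ z∈p-x → contradiction (_ , z∈p-x) p-x≡∅) ∘ x∈p⇒x≡y⊎x∈p-y x
... | yes (y , y∈p-x) = x , y , Sum.map₂ (∣p∣≤1⇒x∈p⇒y∈p⇒y≡x ∣p-x∣≤1 y∈p-x) ∘ x∈p⇒x≡y⊎x∈p-y x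
  where
  ∣p-x∣≤1 : ∣ p - x ∣ ≤ 1
  ∣p-x∣≤1 = ≤-pred (≤-trans (x∈p⇒∣p-x∣<∣p∣ x∈p) ∣p∣≤2)

∣p∪q∣≤∣p∣+∣q∣ : ∀ {m} (p q : Subset m) → ∣ p ∪ q ∣ ≤ ∣ p ∣ + ∣ q ∣
∣p∪q∣≤∣p∣+∣q∣ []            []            = z≤n
∣p∪q∣≤∣p∣+∣q∣ (inside  ∷ p) (s ∷ q)       =
  s≤s (≤-trans (∣p∪q∣≤∣p∣+∣q∣ p q) (+-monoʳ-≤ ∣ p ∣ (∣p∣≤∣x∷p∣ s q)))
∣p∪q∣≤∣p∣+∣q∣ (outside ∷ p) (inside  ∷ q) =
  ≤-trans (s≤s (∣p∪q∣≤∣p∣+∣q∣ p q)) (≤-reflexive (sym (+-suc ∣ p ∣ ∣ q ∣)))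
∣p∪q∣≤∣p∣+∣q∣ (outside ∷ p) (outside ∷ q) = ∣p∪q∣≤∣p∣+∣q∣ p q

∣⁅x⁆∪p∣≤1+∣p∣ : ∀ {m} (x : Fin m) (p : Subset m) → ∣ ⁅ x ⁆ ∪ p ∣ ≤ suc ∣ p ∣
∣⁅x⁆∪p∣≤1+∣p∣ x p = subst (λ k → ∣ ⁅ x ⁆ ∪ p ∣ ≤ k + ∣ p ∣) (∣⁅x⁆∣≡1 x) (∣p∪q∣≤∣p∣+∣q∣ ⁅ x ⁆ p)

∣⁅x⁆∪⁅y⁆∣≤2 : ∀ {m} (x y : Fin m) → ∣ ⁅ x ⁆ ∪ ⁅ y ⁆ ∣ ≤ 2
∣⁅x⁆∪⁅y⁆∣≤2 x y = ≤-trans (∣⁅x⁆∪p∣≤1+∣p∣ x ⁅ y ⁆) (≤-reflexive (cong suc (∣⁅x⁆∣≡1 y)))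

∣⁅x⁆∪⁅y⁆∪⁅z⁆∣≤3 : ∀ {m} (x y z : Fin m) → ∣ ⁅ x ⁆ ∪ ⁅ y ⁆ ∪ ⁅ z ⁆ ∣ ≤ 3
∣⁅x⁆∪⁅y⁆∪⁅z⁆∣≤3 x y z = ≤-trans (∣⁅x⁆∪p∣≤1+∣p∣ x (⁅ y ⁆ ∪ ⁅ z ⁆)) (s≤s (∣⁅x⁆∪⁅y⁆∣≤2 y z))

closedNbhd : (G : Graph) → Fin (n G) → Fin (n G) → Bool
closedNbhd G v u = eqb u v ∨ adj G u v

closedNbhd-refl : ∀ G v → closedNbhd G v v ≡ true
closedNbhd-refl G v rewrite eqb-refl v = refl

InClosedNbhd⇒closedNbhd : ∀ G {u v} → InClosedNbhd G u v → closedNbhd G v u ≡ true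
InClosedNbhd⇒closedNbhd G {u}     (inj₁ refl) = closedNbhd-refl G u
InClosedNbhd⇒closedNbhd G {u} {v} (inj₂ u~v)  rewrite u~v = ∨-zeroʳ (eqb u v)

closedNbhd⇒InClosedNbhd : ∀ G {u v} → closedNbhd G v u ≡ true → InClosedNbhd G u v
closedNbhd⇒InClosedNbhd G {u} {v} u∈N[v] with u ≟ v
... | yes u≡v = inj₁ u≡v
... | no  _   = inj₂ u∈N[v]

eqb-combine : ∀ {k l} (x g : Fin k) (y h : Fin l) →
              eqb (combine x y) (combine g h) ≡ eqb x g ∧ eqb y h
eqb-combine x g y h with x ≟ g | y ≟ h
... | yes refl | yes refl = eqb-refl (combine x y)
... | no  x≢g  | _        =
  dec-false (combine x y ≟ combine g h) (x≢g ∘ proj₁ ∘ combine-injective x y g h)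
... | yes _    | no  y≢h  =
  dec-false (combine x y ≟ combine g h) (y≢h ∘ proj₂ ∘ combine-injective x y g h)

modAdj′-combine : ∀ G H x y g h → modAdj′ G H (combine x y) (combine g h) ≡ modAdj G H x y g h
modAdj′-combine G H x y g h =
  cong₂ (λ (p q : Fin (n G) × Fin (n H)) → modAdj G H (proj₁ p) (proj₂ p) (proj₁ q) (proj₂ q))
        (remQuot-combine x y) (remQuot-combine g h)

-- The first four disjuncts on the left expand (e₁ ∨ a₁) ∧ (e₂ ∨ a₂), the last one
-- is not (e₁ ∨ a₁) ∧ not (e₂ ∨ a₂).
∧∨modAdj≡not-xor : ∀ e₁ a₁ e₂ a₂ →
  (e₁ ∧ e₂) ∨ (e₁ ∧ a₂) ∨ (a₁ ∧ e₂) ∨ (a₁ ∧ a₂) ∨ (not e₁ ∧ not e₂ ∧ not a₁ ∧ not a₂)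
    ≡ not ((e₁ ∨ a₁) xor (e₂ ∨ a₂))
∧∨modAdj≡not-xor true  true  true  true  = refl
∧∨modAdj≡not-xor true  true  true  false = refl
∧∨modAdj≡not-xor true  true  false true  = refl
∧∨modAdj≡not-xor true  true  false false = refl
∧∨modAdj≡not-xor true  false true  true  = refl
∧∨modAdj≡not-xor true  false true  false = refl
∧∨modAdj≡not-xor true  false false true  = refl
∧∨modAdj≡not-xor true  false false false = refl
∧∨modAdj≡not-xor false true  true  true  = refl
∧∨modAdj≡not-xor false true  true  false = refl
∧∨modAdj≡not-xor false true  false true  = refl
∧∨modAdj≡not-xor false true  false false = refl
∧∨modAdj≡not-xor false false true  true  = refl
∧∨modAdj≡not-xor false false true  false = refl
∧∨modAdj≡not-xor false false false true  = refl
∧∨modAdj≡not-xor false false false false = refl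

closedNbhd-◇ : ∀ G H x y g h →
  closedNbhd (G ◇ H) (combine g h) (combine x y) ≡ not (closedNbhd G g x xor closedNbhd H h y)
closedNbhd-◇ G H x y g h = begin
  eqb (combine x y) (combine g h) ∨ modAdj′ G H (combine x y) (combine g h)
    ≡⟨ cong₂ _∨_ (eqb-combine x g y h) (modAdj′-combine G H x y g h) ⟩
  (eqb x g ∧ eqb y h) ∨ modAdj G H x y g h
    ≡⟨ ∧∨modAdj≡not-xor (eqb x g) (adj G x g) (eqb y h) (adj H y h) ⟩
  not (closedNbhd G g x xor closedNbhd H h y) ∎
  where open ≡-Reasoning

not-xor≡true⇔≡ : ∀ {a b} → not (a xor b) ≡ true ⇔ a ≡ b
not-xor≡true⇔≡ = mk⇔ to′ from′
  where
  to′ : ∀ {a b} → not (a xor b) ≡ true → a ≡ b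
  to′ {true}  {true}  _ = refl
  to′ {false} {false} _ = refl
  from′ : ∀ {a b} → a ≡ b → not (a xor b) ≡ true
  from′ {a} refl = cong not (xor-same a)

InClosedNbhd-◇ : ∀ G H {x y g h} →
  InClosedNbhd (G ◇ H) (combine x y) (combine g h) ⇔ (closedNbhd G g x ≡ closedNbhd H h y)
InClosedNbhd-◇ G H {x} {y} {g} {h} = mk⇔
  (to not-xor≡true⇔≡ ∘ trans (sym (closedNbhd-◇ G H x y g h)) ∘ InClosedNbhd⇒closedNbhd (G ◇ H))
  (closedNbhd⇒InClosedNbhd (G ◇ H) ∘ trans (closedNbhd-◇ G H x y g h) ∘ from not-xor≡true⇔≡)

Nonconstant : {X : Set} → (X → Bool) → Set
Nonconstant f = ∃ (λ x → f x ≡ false) × ∃ (λ x → f x ≡ true)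

if-then-true-else-false : ∀ b → (if b then true else false) ≡ b
if-then-true-else-false true  = refl
if-then-true-else-false false = refl

if-then-false-else-true : ∀ b → (if b then false else true) ≡ not b
if-then-false-else-true true  = refl
if-then-false-else-true false = refl

module _ {X Y : Set} {a₁ a₂ : X → Bool} {b₁ b₂ : Y → Bool}
         (cover : ∀ x y → a₁ x ≡ b₁ y ⊎ a₂ x ≡ b₂ y) where

  cover-determines : ∀ {x₀ x₁} → a₁ x₀ ≡ false → a₁ x₁ ≡ true →
                     ∀ y → b₂ y ≡ (if b₁ y then a₂ x₀ else a₂ x₁)
  cover-determines {x₀} {x₁} a₁x₀≡false a₁x₁≡true y with b₁ y | cover x₀ y | cover x₁ y
  ... | true  | inj₂ e | _      = sym e
  ... | true  | inj₁ e | _      = contradiction (trans (sym a₁x₀≡false) e) λ ()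
  ... | false | _      | inj₂ e = sym e
  ... | false | _      | inj₁ e = contradiction (trans (sym a₁x₁≡true) e) λ ()

  cover⇒agree : Nonconstant a₁ → Nonconstant b₂ → ¬ b₂ ≗ not ∘ b₁ → b₂ ≗ b₁
  cover⇒agree ((x₀ , a₁x₀≡false) , (x₁ , a₁x₁≡true))
              ((y₀ , b₂y₀≡false) , (y₁ , b₂y₁≡true)) b₂≉not∘b₁
    with a₂ x₀ | a₂ x₁ | cover-determines a₁x₀≡false a₁x₁≡true
  ... | true  | true  | b₂≡if =
    contradiction (trans (sym b₂y₀≡false) (trans (b₂≡if y₀) (if-eta (b₁ y₀)))) λ ()
  ... | false | false | b₂≡if =
    contradiction (trans (sym b₂y₁≡true) (trans (b₂≡if y₁) (if-eta (b₁ y₁)))) λ ()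
  ... | true  | false | b₂≡if = λ y → trans (b₂≡if y) (if-then-true-else-false (b₁ y))
  ... | false | true  | b₂≡if =
    contradiction (λ y → trans (b₂≡if y) (if-then-false-else-true (b₁ y))) b₂≉not∘b₁

no-two-point-cover : ∀ {X Y : Set} {a₁ a₂ : X → Bool} {b₁ b₂ : Y → Bool} →
  Nonconstant a₁ → Nonconstant a₂ → Nonconstant b₁ → Nonconstant b₂ →
  ¬ a₂ ≗ not ∘ a₁ → ¬ b₂ ≗ not ∘ b₁ →
  ¬ (∀ x y → a₁ x ≡ b₁ y ⊎ a₂ x ≡ b₂ y)
no-two-point-cover {a₁ = a₁} {a₂} {b₁} {b₂}
  a₁≁@((x₀ , a₁x₀≡false) , _) a₂≁ b₁≁@(_ , (y₁ , b₁y₁≡true)) b₂≁ a₂≉not∘a₁ b₂≉not∘b₁ cover =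
  contradiction (trans (sym a₁x₀≡false) (trans (collapse x₀ y₁) b₁y₁≡true)) λ ()
  where
  b₂≗b₁ : b₂ ≗ b₁
  b₂≗b₁ = cover⇒agree cover a₁≁ b₂≁ b₂≉not∘b₁
  a₂≗a₁ : a₂ ≗ a₁
  a₂≗a₁ = cover⇒agree (λ y x → Sum.map sym sym (cover x y)) b₁≁ a₂≁ a₂≉not∘a₁
  collapse : ∀ x y → a₁ x ≡ b₁ y
  collapse x y = [ id , (λ e → trans (sym (a₂≗a₁ x)) (trans e (b₂≗b₁ y))) ]′ (cover x y)

dominating-pair : ∀ G {D : Subset (n G)} → Nonempty D → Dominating G D → ∣ D ∣ ≤ 2 →
                  ∃₂ λ v w → ∀ u → InClosedNbhd G u v ⊎ InClosedNbhd G u w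
dominating-pair G D≢∅ dom ∣D∣≤2 with v , w , D⊆vw ← ∣p∣≤2⇒⊆pair D≢∅ ∣D∣≤2 = v , w , covered
  where
  covered : ∀ u → InClosedNbhd G u v ⊎ InClosedNbhd G u w
  covered u with d , d∈D , u∈N[d] ← dom u =
    Sum.map (λ { refl → u∈N[d] }) (λ { refl → u∈N[d] }) (D⊆vw d∈D)

γ≡2⇒dominating-pair : ∀ G → DominationNumberIs G 2 →
                      ∃₂ λ v w → ∀ u → InClosedNbhd G u v ⊎ InClosedNbhd G u w
γ≡2⇒dominating-pair G ((D , dom , ∣D∣≡2) , _) =
  dominating-pair G (0<∣p∣⇒Nonempty (subst (0 <_) (sym ∣D∣≡2) (s≤s z≤n))) dom (≤-reflexive ∣D∣≡2)

dominating-size≡bound : ∀ G {k} {D : Subset (n G)} → (∀ D → Dominating G D → ¬ ∣ D ∣ < k) →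
                        Dominating G D → ∣ D ∣ ≤ k → ∣ D ∣ ≡ k
dominating-size≡bound G noSmaller dom ∣D∣≤k = ≤∧≮⇒≡ ∣D∣≤k (noSmaller _ dom)

γ≥2⇒closedNbhd-nonconstant : ∀ G → (∀ D → Dominating G D → ¬ ∣ D ∣ < 2) →
                             ∀ v → Nonconstant (closedNbhd G v)
γ≥2⇒closedNbhd-nonconstant G γ≥2 v =
  map₂ ¬-not (¬∀⟶∃¬ (n G) (λ u → closedNbhd G v u ≡ true) (λ u → closedNbhd G v u ≟ᵇ true)
                     ⁅v⁆-not-dominating)
  , (v , closedNbhd-refl G v)
  where
  ⁅v⁆-not-dominating : ¬ (∀ u → closedNbhd G v u ≡ true)
  ⁅v⁆-not-dominating universal =
    γ≥2 ⁅ v ⁆ (λ u → v , x∈⁅x⁆ v , closedNbhd⇒InClosedNbhd G (universal u))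
        (≤-reflexive (cong suc (∣⁅x⁆∣≡1 v)))

complementary⇒ECD : ∀ G {v w} → closedNbhd G w ≗ not ∘ closedNbhd G v → ECD G (⁅ v ⁆ ∪ ⁅ w ⁆)
complementary⇒ECD G {v} {w} N[w]≗∁N[v] = dom , unique
  where
  dom : Dominating G (⁅ v ⁆ ∪ ⁅ w ⁆)
  dom u with closedNbhd G v u in u∈?N[v]
  ... | true  = v , x∈p∪q⁺ (inj₁ (x∈⁅x⁆ v)) , closedNbhd⇒InClosedNbhd G u∈?N[v]
  ... | false = w , x∈p∪q⁺ (inj₂ (x∈⁅x⁆ w))
                  , closedNbhd⇒InClosedNbhd G (trans (N[w]≗∁N[v] u) (cong not u∈?N[v]))
  disjoint : ∀ {u} → InClosedNbhd G u v → ¬ InClosedNbhd G u w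
  disjoint u∈N[v] u∈N[w] = contradiction
    (trans (cong not (sym (InClosedNbhd⇒closedNbhd G u∈N[v])))
           (trans (sym (N[w]≗∁N[v] _)) (InClosedNbhd⇒closedNbhd G u∈N[w])))
    λ ()
  members : ∀ {d} → d ∈ ⁅ v ⁆ ∪ ⁅ w ⁆ → d ≡ v ⊎ d ≡ w
  members = Sum.map (x∈⁅y⁆⇒x≡y v) (x∈⁅y⁆⇒x≡y w) ∘ x∈p∪q⁻ ⁅ v ⁆ ⁅ w ⁆
  unique : ∀ u d d′ → d ∈ ⁅ v ⁆ ∪ ⁅ w ⁆ → d′ ∈ ⁅ v ⁆ ∪ ⁅ w ⁆ →
           InClosedNbhd G u d → InClosedNbhd G u d′ → d ≡ d′
  unique _ _ _ d∈D d′∈D u∈N[d] u∈N[d′] with members d∈D | members d′∈D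
  ... | inj₁ refl | inj₁ refl = refl
  ... | inj₂ refl | inj₂ refl = refl
  ... | inj₁ refl | inj₂ refl = contradiction u∈N[d′] (disjoint u∈N[d])
  ... | inj₂ refl | inj₁ refl = contradiction u∈N[d] (disjoint u∈N[d′])

noECD₂⇒¬complementary : ∀ G → (∀ D → Dominating G D → ¬ ∣ D ∣ < 2) →
                        (∀ (D : Subset (n G)) → ∣ D ∣ ≡ 2 → ¬ ECD G D) →
                        ∀ v w → ¬ closedNbhd G w ≗ not ∘ closedNbhd G v
noECD₂⇒¬complementary G γ≥2 noECD₂ v w N[w]≗∁N[v] =
  noECD₂ _ (dominating-size≡bound G γ≥2 (proj₁ ecd) (∣⁅x⁆∪⁅y⁆∣≤2 v w)) ecd
  where
  ecd : ECD G (⁅ v ⁆ ∪ ⁅ w ⁆)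
  ecd = complementary⇒ECD G N[w]≗∁N[v]

agree-somewhere : ∀ {a₁ a₂ b₁ b₂} → a₁ ≡ true ⊎ a₂ ≡ true → b₁ ≡ true ⊎ b₂ ≡ true →
                  a₁ ≡ b₁ ⊎ a₂ ≡ b₂ ⊎ a₁ ≡ b₂
agree-somewhere                      (inj₁ refl) (inj₁ refl) = inj₁ refl
agree-somewhere                      (inj₁ refl) (inj₂ refl) = inj₂ (inj₂ refl)
agree-somewhere                      (inj₂ refl) (inj₂ refl) = inj₂ (inj₁ refl)
agree-somewhere {true}               (inj₂ refl) (inj₁ refl) = inj₁ refl
agree-somewhere {false} {b₂ = true}  (inj₂ refl) (inj₁ refl) = inj₂ (inj₁ refl)
agree-somewhere {false} {b₂ = false} (inj₂ refl) (inj₁ refl) = inj₂ (inj₂ refl)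

◇-dominated-by-three : ∀ G H {g₁ g₂ h₁ h₂} →
  (∀ x → InClosedNbhd G x g₁ ⊎ InClosedNbhd G x g₂) →
  (∀ y → InClosedNbhd H y h₁ ⊎ InClosedNbhd H y h₂) →
  Dominating (G ◇ H) (⁅ combine g₁ h₁ ⁆ ∪ ⁅ combine g₂ h₂ ⁆ ∪ ⁅ combine g₁ h₂ ⁆)
◇-dominated-by-three G H {g₁} {g₂} {h₁} {h₂} coverG coverH u
  with x , y , refl ← combine-surjective {n G} {n H} u
  with agree-somewhere (Sum.map (InClosedNbhd⇒closedNbhd G) (InClosedNbhd⇒closedNbhd G) (coverG x))
                       (Sum.map (InClosedNbhd⇒closedNbhd H) (InClosedNbhd⇒closedNbhd H) (coverH y))
... | inj₁ a₁≡b₁        =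
  combine g₁ h₁ , x∈p∪q⁺ (inj₁ (x∈⁅x⁆ _)) , from (InClosedNbhd-◇ G H) a₁≡b₁
... | inj₂ (inj₁ a₂≡b₂) =
  combine g₂ h₂ , x∈p∪q⁺ (inj₂ (x∈p∪q⁺ (inj₁ (x∈⁅x⁆ _)))) , from (InClosedNbhd-◇ G H) a₂≡b₂
... | inj₂ (inj₂ a₁≡b₂) =
  combine g₁ h₂ , x∈p∪q⁺ (inj₂ (x∈p∪q⁺ (inj₂ (x∈⁅x⁆ _)))) , from (InClosedNbhd-◇ G H) a₁≡b₂

◇-no-dominating-pair : ∀ G H →
  (∀ g → Nonconstant (closedNbhd G g)) → (∀ h → Nonconstant (closedNbhd H h)) →
  (∀ g g′ → ¬ closedNbhd G g′ ≗ not ∘ closedNbhd G g) →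
  (∀ h h′ → ¬ closedNbhd H h′ ≗ not ∘ closedNbhd H h) →
  ∀ p q → ¬ (∀ u → InClosedNbhd (G ◇ H) u p ⊎ InClosedNbhd (G ◇ H) u q)
◇-no-dominating-pair G H nonconstG nonconstH ¬complG ¬complH p q cover
  with g₁ , h₁ , refl ← combine-surjective {n G} {n H} p
     | g₂ , h₂ , refl ← combine-surjective {n G} {n H} q
  = no-two-point-cover (nonconstG g₁) (nonconstG g₂) (nonconstH h₁) (nonconstH h₂)
                       (¬complG g₁ g₂) (¬complH h₁ h₂)
                       λ x y → Sum.map (to (InClosedNbhd-◇ G H)) (to (InClosedNbhd-◇ G H))
                                       (cover (combine x y))

◇-no-small-dominating-set : ∀ G H → DominationNumberIs G 2 → DominationNumberIs H 2 →
  (∀ (D : Subset (n G)) → ∣ D ∣ ≡ 2 → ¬ ECD G D) →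
  (∀ (D : Subset (n H)) → ∣ D ∣ ≡ 2 → ¬ ECD H D) →
  ∀ D → Dominating (G ◇ H) D → ¬ ∣ D ∣ < 3
◇-no-small-dominating-set G H γG γH noECD₂G noECD₂H D dom ∣D∣<3
  with g , _ ← γ≡2⇒dominating-pair G γG
     | h , _ ← γ≡2⇒dominating-pair H γH
  with p , q , coverPQ ←
         dominating-pair (G ◇ H) (_ , proj₁ (proj₂ (dom (combine g h)))) dom (≤-pred ∣D∣<3)
  = ◇-no-dominating-pair G H
      (γ≥2⇒closedNbhd-nonconstant G (proj₂ γG)) (γ≥2⇒closedNbhd-nonconstant H (proj₂ γH))
      (noECD₂⇒¬complementary G (proj₂ γG) noECD₂G) (noECD₂⇒¬complementary H (proj₂ γH) noECD₂H)
      p q coverPQ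

proposition28 : (G H : Graph) →
    DominationNumberIs G 2 → DominationNumberIs H 2 →
    (∀ (D : Subset (n G)) → ∣ D ∣ ≡ 2 → ¬ ECD G D) →
    (∀ (D : Subset (n H)) → ∣ D ∣ ≡ 2 → ¬ ECD H D) →
    DominationNumberIs (G ◇ H) 3
proposition28 G H γG γH noECD₂G noECD₂H
  with g₁ , g₂ , coverG ← γ≡2⇒dominating-pair G γG
     | h₁ , h₂ , coverH ← γ≡2⇒dominating-pair H γH
  = (D₃ , D₃-dominates , dominating-size≡bound (G ◇ H) γ≥3 D₃-dominates ∣D₃∣≤3) , γ≥3
  where
  D₃ : Subset (n G * n H)
  D₃ = ⁅ combine g₁ h₁ ⁆ ∪ ⁅ combine g₂ h₂ ⁆ ∪ ⁅ combine g₁ h₂ ⁆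
  D₃-dominates : Dominating (G ◇ H) D₃
  D₃-dominates = ◇-dominated-by-three G H coverG coverH
  ∣D₃∣≤3 : ∣ D₃ ∣ ≤ 3
  ∣D₃∣≤3 = ∣⁅x⁆∪⁅y⁆∪⁅z⁆∣≤3 (combine g₁ h₁) (combine g₂ h₂) (combine g₁ h₂)
  γ≥3 : ∀ D → Dominating (G ◇ H) D → ¬ ∣ D ∣ < 3
  γ≥3 = ◇-no-small-dominating-set G H γG γH noECD₂G noECD₂H
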